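{- Let $\Gamma$ be a digraph with vertex set $V=\{1,\dots,n\}$, $n>1$, and let $S=(s_{ij})\in\mathbb{R}^{n\times n}$ determine a transitional measure for $\Gamma$. Then $s_{ij}\,s_{ji}<s_{ii}\,s_{jj}$ for all $1\le i,j\le n$ with $j\ne i$.
   Context: A digraph $\Gamma$ here is a weighted directed multigraph without loops, with vertex set $\{1,\dots,n\}$, $n>1$; each arc has a positive weight. A directed path from $v_0$ to $v_k$ is an alternating sequence $v_0,a_1,v_1,\dots,a_k,v_k$ of vertices and arcs in which all vertices are distinct and each $a_i$ is an arc from $v_{i-1}$ to $v_i$; for each vertex $v_0$ the sequence $v_0$ (length $0$, no arcs) is the unique path from $v_0$ to $v_0$. A matrix $S=(s_{ij})$ satisfies the transition inequality if $s_{ij}s_{jk}\le s_{ik}s_{jj}$ for all $i,j,k$. It satisfies the graph bottleneck identity w.r.t. $\Gamma$ if for all $i,j,k\in\{1,\dots,n\}$: $s_{ij}s_{jk}=s_{ik}s_{jj}$ holds if and only if every directed path in $\Gamma$ from $i$ to $k$ contains $j$. $S$ determines a transitional measure for $\Gamma$ if it satisfies both the transition inequality and the graph bottleneck identity w.r.t. $\Gamma$. -}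

module Defs where

open import Data.Nat using (ℕ)
open import Data.Fin using (Fin)
open import Data.List using (List; []; _∷_)
open import Data.List.Membership.Propositional using (_∈_)
open import Data.List.Relation.Unary.Unique.Propositional using (Unique)
open import Data.Product using (Σ; ∃; _×_; _,_)
open import Data.Sum using (_⊎_)
open import Relation.Nullary using (¬_)
open import Relation.Binary.PropositionalEquality using (_≡_)

-- The real numbers, axiomatised as a complete ordered field.
-- (agda-stdlib has no ℝ; any model of this record is isomorphic to ℝ.)

record RealField : Set₁ where
  infixl 6 _+_
  infixl 7 _*_
  infix 4 _≤_
  field
    Carrier : Set
    _+_ _*_ : Carrier → Carrier → Carrier
    -_      : Carrier → Carrier
    0# 1#   : Carrier
    _≤_     : Carrier → Carrier → Set
    +-assoc     : ∀ x y z → (x + y) + z ≡ x + (y + z)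
    +-comm      : ∀ x y → x + y ≡ y + x
    +-identityˡ : ∀ x → 0# + x ≡ x
    -‿inverseˡ  : ∀ x → (- x) + x ≡ 0#
    *-assoc     : ∀ x y z → (x * y) * z ≡ x * (y * z)
    *-comm      : ∀ x y → x * y ≡ y * x
    *-identityˡ : ∀ x → 1# * x ≡ x
    distribˡ    : ∀ x y z → x * (y + z) ≡ (x * y) + (x * z)
    0≢1         : ¬ (0# ≡ 1#)
    *-inverse   : ∀ x → ¬ (x ≡ 0#) → ∃ λ y → x * y ≡ 1#
    ≤-refl      : ∀ x → x ≤ x
    ≤-trans     : ∀ {x y z} → x ≤ y → y ≤ z → x ≤ z
    ≤-antisym   : ∀ {x y} → x ≤ y → y ≤ x → x ≡ y
    ≤-total     : ∀ x y → (x ≤ y) ⊎ (y ≤ x)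
    +-mono-≤    : ∀ {x y} z → x ≤ y → x + z ≤ y + z
    *-nonneg    : ∀ {x y} → 0# ≤ x → 0# ≤ y → 0# ≤ x * y
    lub : (P : Carrier → Set) → ∃ P →
          (∃ λ b → ∀ x → P x → x ≤ b) →
          ∃ λ s → (∀ x → P x → x ≤ s) × (∀ b → (∀ x → P x → x ≤ b) → s ≤ b)

  _<_ : Carrier → Carrier → Set
  x < y = (x ≤ y) × ¬ (x ≡ y)
  infix 4 _<_

module _ (R : RealField) where
  open RealField R

  record Arc (n : ℕ) : Set where
    constructor arc
    field
      src : Fin n
      tgt : Fin n
      wt  : Carrier

  -- Weighted directed multigraph without loops on vertex set Fin n,
  -- positive weights.  The arc list may contain repetitions (multigraph).
  record Digraph (n : ℕ) : Set where
    field
      arcs     : List (Arc n)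
      noLoops  : ∀ a → a ∈ arcs → ¬ (Arc.src a ≡ Arc.tgt a)
      positive : ∀ a → a ∈ arcs → 0# < Arc.wt a

  data Walk {n : ℕ} (Γ : Digraph n) : Fin n → Fin n → Set where
    stop : (v : Fin n) → Walk Γ v v
    step : ∀ {w} (u : Fin n) (a : Arc n) → a ∈ Digraph.arcs Γ →
           Arc.src a ≡ u → Walk Γ (Arc.tgt a) w → Walk Γ u w

  vertices : ∀ {n} {Γ : Digraph n} {u w} → Walk Γ u w → List (Fin n)
  vertices (stop v)            = v ∷ []
  vertices (step u a _ _ rest) = u ∷ vertices rest

  Path : ∀ {n} (Γ : Digraph n) → Fin n → Fin n → Set
  Path Γ u w = Σ (Walk Γ u w) λ p → Unique (vertices p)

  Matrix : ℕ → Set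
  Matrix n = Fin n → Fin n → Carrier

  TransitionInequality : ∀ {n} → Matrix n → Set
  TransitionInequality {n} s = ∀ (i j k : Fin n) → s i j * s j k ≤ s i k * s j j

  GraphBottleneckIdentity : ∀ {n} → Digraph n → Matrix n → Set
  GraphBottleneckIdentity {n} Γ s = ∀ (i j k : Fin n) →
    ((s i j * s j k ≡ s i k * s j j) → ∀ (p : Path Γ i k) → j ∈ vertices (Σ.proj₁ p))
    × ((∀ (p : Path Γ i k) → j ∈ vertices (Σ.proj₁ p)) → s i j * s j k ≡ s i k * s j j)

  TransitionalMeasure : ∀ {n} → Digraph n → Matrix n → Set
  TransitionalMeasure Γ s = TransitionInequality s × GraphBottleneckIdentity Γ s

-- Take k = i in the transition inequality: s_ij s_ji ≤ s_ii s_jj.  The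
-- one-vertex path from i to i avoids j ≠ i, so by the graph bottleneck
-- identity the inequality cannot be an equality.

module Submission where

open import Defs
open import Data.Nat using (ℕ)
import Data.Nat as ℕ
open import Data.Fin using (Fin)
open import Data.List using ([]; _∷_)
open import Data.List.Membership.Propositional using (_∉_)
open import Data.List.Relation.Unary.Any using (here)
open import Data.List.Relation.Unary.All using ([])
open import Data.List.Relation.Unary.AllPairs using ([]; _∷_)
open import Data.Product using (_,_; proj₁)
open import Relation.Nullary using (¬_)
open import Relation.Binary.PropositionalEquality using (_≡_)

module _ (R : RealField) {n : ℕ} where
  open RealField R using (_*_; _<_)

  trivialPath : (Γ : Digraph R n) (v : Fin n) → Path R Γ v v
  trivialPath Γ v = stop v , [] ∷ []

  ∉-trivialPath : ∀ (Γ : Digraph R n) {u v : Fin n} → ¬ (u ≡ v) →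
                  u ∉ vertices R (proj₁ (trivialPath Γ v))
  ∉-trivialPath Γ u≢v (here u≡v) = u≢v u≡v

  transitional-strict : ∀ {Γ : Digraph R n} {s : Matrix R n} → TransitionalMeasure R Γ s →
                        ∀ {i j k} (p : Path R Γ i k) → j ∉ vertices R (proj₁ p) →
                        s i j * s j k < s i k * s j j
  transitional-strict (ti , gbi) {i} {j} {k} p j∉p =
    ti i j k , λ eq → j∉p (proj₁ (gbi i j k) eq p)

lemma2 : (R : RealField) (n : ℕ) → 1 ℕ.< n →
    (Γ : Digraph R n) (s : Matrix R n) → TransitionalMeasure R Γ s →
    ∀ (i j : Fin n) → ¬ (j ≡ i) →
    RealField._<_ R (RealField._*_ R (s i j) (s j i)) (RealField._*_ R (s i i) (s j j))
lemma2 R n _ Γ s measure i j j≢i =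
  transitional-strict R measure (trivialPath R Γ i) (∉-trivialPath R Γ j≢i)
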